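{- $\mathrm{NFU}$ proves: the category $\mathbf{Rel}$ has coproducts indexed by $\{\{i\} \mid i \in V\}$; that is, letting $\mathbf{Sing}$ be the category whose set of objects is $\{\{i\} \mid i \in V\}$ and whose only morphisms are identities, every functor $\mathbf F : \mathbf{Sing} \rightarrow \mathbf{Rel}$ has a colimit (coproduct) in $\mathbf{Rel}$.
   Context: $\mathrm{NFU}$ is Jensen's variant of Quine's New Foundations: an untyped first-order set theory with extensionality only for nonempty sets (atoms/urelements allowed; one atom is designated as the empty set $\varnothing$), the schema of stratified comprehension ($\exists y \forall x (x \in y \leftrightarrow \phi)$ for formulas $\phi$ whose variables can be assigned natural-number types so that $u \in w$ forces type$(w)$ = type$(u)+1$ and $u = w$ forces equal types), the axiom of infinity, the axiom of choice, and a type-level ordered pair $\langle x,y\rangle$. $V$ is the universal set. $\mathbf{Rel}$ is the category whose objects are all sets and whose morphisms $A \to B$ are binary relations $R \subseteq A \times B$, composed as relations; neither an object nor a morphism of $\mathbf{Rel}$ may be an atom other than $\varnothing$. -}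

module Defs where

open import Data.Nat using (ℕ; suc)
open import Data.Fin using (Fin; zero; suc)
open import Data.Empty using (⊥)
open import Data.Unit using (⊤)
open import Data.Product using (Σ; Σ-syntax; _×_; _,_)
open import Data.Sum using (_⊎_)
open import Relation.Nullary using (¬_)
open import Relation.Binary.PropositionalEquality using (_≡_)
open import Function.Bundles using (_⇔_)
open import Axiom.ExcludedMiddle using (ExcludedMiddle)
open import Level using (0ℓ)

-- Syntax of the first-order language of NFU:  ∈, =, the constant ∅
-- and the (type-level) ordered pair ⟨_,_⟩.  Variables are de Bruijn
-- indices into a context of size n.

data Term (n : ℕ) : Set where
  var  : Fin n → Term n
  emp  : Term n
  pair : Term n → Term n → Term n

data Formula (n : ℕ) : Set where
  _∈ᶠ_ : Term n → Term n → Formula n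
  _≐_  : Term n → Term n → Formula n
  ⊥ᶠ   : Formula n
  _⇒_  : Formula n → Formula n → Formula n
  _∧ᶠ_ : Formula n → Formula n → Formula n
  _∨ᶠ_ : Formula n → Formula n → Formula n
  ∀ᶠ   : Formula (suc n) → Formula n
  ∃ᶠ   : Formula (suc n) → Formula n

-- Stratification: an assignment of natural-number types to all
-- (free and bound) variables such that u ∈ w forces
-- type(w) = type(u)+1, u = w forces equal types, and the type-level
-- pair ⟨u,w⟩ has the same type as u and w.  (∅ may take any type.)

_∷ᵗ_ : {n : ℕ} → ℕ → (Fin n → ℕ) → Fin (suc n) → ℕ
(k ∷ᵗ σ) zero    = k
(k ∷ᵗ σ) (suc i) = σ i

data HasType {n : ℕ} (σ : Fin n → ℕ) : Term n → ℕ → Set where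
  tvar  : (i : Fin n) → HasType σ (var i) (σ i)
  temp  : (k : ℕ) → HasType σ emp k
  tpair : {a b : Term n} {k : ℕ} → HasType σ a k → HasType σ b k →
          HasType σ (pair a b) k

Strat : {n : ℕ} → (Fin n → ℕ) → Formula n → Set
Strat σ (a ∈ᶠ b) = Σ[ k ∈ ℕ ] (HasType σ a k × HasType σ b (suc k))
Strat σ (a ≐ b)  = Σ[ k ∈ ℕ ] (HasType σ a k × HasType σ b k)
Strat σ ⊥ᶠ       = ⊤
Strat σ (φ ⇒ ψ)  = Strat σ φ × Strat σ ψ
Strat σ (φ ∧ᶠ ψ) = Strat σ φ × Strat σ ψ
Strat σ (φ ∨ᶠ ψ) = Strat σ φ × Strat σ ψ
Strat σ (∀ᶠ φ)   = Σ[ k ∈ ℕ ] Strat (k ∷ᵗ σ) φ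
Strat σ (∃ᶠ φ)   = Σ[ k ∈ ℕ ] Strat (k ∷ᵗ σ) φ

Stratified : {n : ℕ} → Formula n → Set
Stratified {n} φ = Σ[ σ ∈ (Fin n → ℕ) ] Strat σ φ

record Structure : Set₁ where
  field
    U     : Set
    _∈_   : U → U → Set
    ∅     : U
    ⟨_,_⟩ : U → U → U

module Sem (M : Structure) where
  open Structure M

  _∷ᵛ_ : {n : ℕ} → U → (Fin n → U) → Fin (suc n) → U
  (x ∷ᵛ ρ) zero    = x
  (x ∷ᵛ ρ) (suc i) = ρ i

  ⟦_⟧ₜ : {n : ℕ} → Term n → (Fin n → U) → U
  ⟦ var i ⟧ₜ ρ    = ρ i
  ⟦ emp ⟧ₜ ρ      = ∅
  ⟦ pair a b ⟧ₜ ρ = ⟨ ⟦ a ⟧ₜ ρ , ⟦ b ⟧ₜ ρ ⟩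

  Sat : {n : ℕ} → (Fin n → U) → Formula n → Set
  Sat ρ (a ∈ᶠ b) = ⟦ a ⟧ₜ ρ ∈ ⟦ b ⟧ₜ ρ
  Sat ρ (a ≐ b)  = ⟦ a ⟧ₜ ρ ≡ ⟦ b ⟧ₜ ρ
  Sat ρ ⊥ᶠ       = ⊥
  Sat ρ (φ ⇒ ψ)  = Sat ρ φ → Sat ρ ψ
  Sat ρ (φ ∧ᶠ ψ) = Sat ρ φ × Sat ρ ψ
  Sat ρ (φ ∨ᶠ ψ) = Sat ρ φ ⊎ Sat ρ ψ
  Sat ρ (∀ᶠ φ)   = (x : U) → Sat (x ∷ᵛ ρ) φ
  Sat ρ (∃ᶠ φ)   = Σ[ x ∈ U ] Sat (x ∷ᵛ ρ) φ

  Nonempty : U → Set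
  Nonempty x = Σ[ z ∈ U ] z ∈ x

  -- a "set": ∅ or a non-atom (an object with an element)
  IsSet : U → Set
  IsSet x = (x ≡ ∅) ⊎ Nonempty x

  IsSingleton : U → Set
  IsSingleton s = Σ[ i ∈ U ] ((z : U) → (z ∈ s) ⇔ (z ≡ i))

  IsFnOn : U → (U → Set) → Set
  IsFnOn f D =
    ((z : U) → z ∈ f → Σ[ x ∈ U ] Σ[ y ∈ U ] (z ≡ ⟨ x , y ⟩ × D x))
    × ((x : U) → D x → Σ[ y ∈ U ] ⟨ x , y ⟩ ∈ f)
    × ((x y y' : U) → ⟨ x , y ⟩ ∈ f → ⟨ x , y' ⟩ ∈ f → y ≡ y')

  Hom : U → U → U → Set
  Hom A B R = IsSet R ×
    ((z : U) → z ∈ R → Σ[ a ∈ U ] Σ[ b ∈ U ] (z ≡ ⟨ a , b ⟩ × a ∈ A × b ∈ B))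

  -- T = S ∘ R  (first R, then S), as relational composition
  IsComp : U → U → U → Set
  IsComp S R T = (z : U) → (z ∈ T) ⇔
    (Σ[ a ∈ U ] Σ[ b ∈ U ] Σ[ c ∈ U ]
       (z ≡ ⟨ a , c ⟩ × ⟨ a , b ⟩ ∈ R × ⟨ b , c ⟩ ∈ S))

  -- Sing is discrete with object set
  -- {{i} | i ∈ V}; a functor is given by its object map F (a set of
  -- pairs ⟨{i}, F{i}⟩ with each F{i} an object of Rel, i.e. a set);
  -- its action on morphisms is forced (identities to identities).

  IsFunctorSingRel : U → Set
  IsFunctorSingRel F =
    IsFnOn F IsSingleton × ((s X : U) → ⟨ s , X ⟩ ∈ F → IsSet X)

  IsCoproduct : U → U → U → Set
  IsCoproduct F C ι =
    IsSet C × IsFnOn ι IsSingleton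
    × ((s X h : U) → ⟨ s , X ⟩ ∈ F → ⟨ s , h ⟩ ∈ ι → Hom X C h)
    × ((Y : U) → IsSet Y → (g : U) → IsFnOn g IsSingleton →
        ((s X h : U) → ⟨ s , X ⟩ ∈ F → ⟨ s , h ⟩ ∈ g → Hom X Y h) →
        Σ[ u ∈ U ] (Hom C Y u
          × ((s i h : U) → ⟨ s , i ⟩ ∈ ι → ⟨ s , h ⟩ ∈ g → IsComp u i h)
          × ((u' : U) → Hom C Y u' →
              ((s i h : U) → ⟨ s , i ⟩ ∈ ι → ⟨ s , h ⟩ ∈ g → IsComp u' i h) →
              u' ≡ u)))

  RelHasSingCoproducts : Set
  RelHasSingCoproducts =
    (F : U) → IsFunctorSingRel F → Σ[ C ∈ U ] Σ[ ι ∈ U ] IsCoproduct F C ι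

  Extensionality : Set
  Extensionality = (x y : U) → Nonempty x →
    ((z : U) → (z ∈ x) ⇔ (z ∈ y)) → x ≡ y

  EmptyIsEmpty : Set
  EmptyIsEmpty = (z : U) → ¬ (z ∈ ∅)

  -- ∃y ∀x (x ∈ y ↔ φ), φ stratified, y not free in φ; variable 0 of φ
  -- is x, the remaining variables are parameters.
  StratComprehension : Set
  StratComprehension = {n : ℕ} (φ : Formula (suc n)) → Stratified φ →
    (ρ : Fin n → U) → Σ[ y ∈ U ] ((x : U) → (x ∈ y) ⇔ Sat (x ∷ᵛ ρ) φ)

  PairAxiom : Set
  PairAxiom = (a b c d : U) → ⟨ a , b ⟩ ≡ ⟨ c , d ⟩ → (a ≡ c) × (b ≡ d)

  Infinity : Set
  Infinity = Σ[ f ∈ U ] (IsFnOn f (λ _ → ⊤)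
    × ((x x' y : U) → ⟨ x , y ⟩ ∈ f → ⟨ x' , y ⟩ ∈ f → x ≡ x')
    × Σ[ y ∈ U ] ((x : U) → ¬ (⟨ x , y ⟩ ∈ f)))

  Choice : Set
  Choice = (A : U) → ((a : U) → a ∈ A → Nonempty a) →
    ((a b : U) → a ∈ A → b ∈ A → Σ[ z ∈ U ] (z ∈ a × z ∈ b) → a ≡ b) →
    Σ[ c ∈ U ] ((a : U) → a ∈ A →
      Σ[ z ∈ U ] (z ∈ a × z ∈ c × ((w : U) → w ∈ a → w ∈ c → w ≡ z)))

record NFUModel : Set₁ where
  field
    structure : Structure
  open Sem structure
  field
    ext       : Extensionality
    empty     : EmptyIsEmpty
    comp      : StratComprehension
    pairAx    : PairAxiom
    infinity  : Infinity
    choice    : Choice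

-- "NFU proves φ" is rendered semantically: φ holds in every model of
-- NFU, the metatheory being classical.
NFUProvesRelSingCoproducts : Set₁
NFUProvesRelSingCoproducts =
  ExcludedMiddle 0ℓ → (M : NFUModel) →
    Sem.RelHasSingCoproducts (NFUModel.structure M)

module Submission where

-- Given a functor F : Sing → Rel, write F{i} for the set X with ⟨{i}, X⟩ ∈ F.
-- The coproduct is the tagged disjoint union
--     C = {⟨i, x⟩ | x ∈ F{i}},   with injections   ι{i} = {⟨x, ⟨i, x⟩⟩ | x ∈ F{i}},
-- and a cocone g({i}) : F{i} → Y factors uniquely through the copairing
--     u = {⟨⟨i, x⟩, y⟩ | ⟨x, y⟩ ∈ g({i})}.
-- The pair is type-level, so the tag i sits at the same type as x; this is
-- what makes all three defining conditions stratified, hence instances of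
-- comprehension.

open import Defs
open import Level using (0ℓ)
open import Axiom.ExcludedMiddle using (ExcludedMiddle)
open import Data.Nat using (ℕ)
open import Data.Fin using (Fin; zero; suc; #_; lift)
open import Data.Empty using (⊥-elim)
open import Data.Product using (Σ-syntax; _×_; _,_; proj₁; proj₂)
open import Data.Sum using (inj₁; inj₂)
open import Relation.Nullary using (yes; no)
open import Relation.Binary.PropositionalEquality using (_≡_; refl; sym; trans; subst)
open import Function.Bundles using (_⇔_; mk⇔; Equivalence)

open Equivalence

renameᵗ : {n m : ℕ} → (Fin n → Fin m) → Term n → Term m
renameᵗ r (var i)    = var (r i)
renameᵗ r emp        = emp
renameᵗ r (pair a b) = pair (renameᵗ r a) (renameᵗ r b)

renameᶠ : {n m : ℕ} → (Fin n → Fin m) → Formula n → Formula m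
renameᶠ r (a ∈ᶠ b) = renameᵗ r a ∈ᶠ renameᵗ r b
renameᶠ r (a ≐ b)  = renameᵗ r a ≐ renameᵗ r b
renameᶠ r ⊥ᶠ       = ⊥ᶠ
renameᶠ r (φ ⇒ ψ)  = renameᶠ r φ ⇒ renameᶠ r ψ
renameᶠ r (φ ∧ᶠ ψ) = renameᶠ r φ ∧ᶠ renameᶠ r ψ
renameᶠ r (φ ∨ᶠ ψ) = renameᶠ r φ ∨ᶠ renameᶠ r ψ
renameᶠ r (∀ᶠ φ)   = ∀ᶠ (renameᶠ (lift 1 r) φ)
renameᶠ r (∃ᶠ φ)   = ∃ᶠ (renameᶠ (lift 1 r) φ)

-- The disjoint union.  Variables z, F:
--   ∃i ∃s ∃X ∃x. z = ⟨i, x⟩ ∧ i ∈ s ∧ ⟨s, X⟩ ∈ F ∧ x ∈ X.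
unionFormula : Formula 2
unionFormula = ∃ᶠ (∃ᶠ (∃ᶠ (∃ᶠ ((var (# 4) ≐ pair (var (# 3)) (var (# 0))) ∧ᶠ
  ((var (# 3) ∈ᶠ var (# 2)) ∧ᶠ ((pair (var (# 2)) (var (# 1)) ∈ᶠ var (# 5)) ∧ᶠ
   (var (# 0) ∈ᶠ var (# 1))))))))

-- Types: z, i, x at 0;  s, X at 1;  F at 2.
unionStratified : Stratified unionFormula
unionStratified = (λ { zero → 0 ; (suc _) → 2 }) , 0 , 1 , 1 , 0 ,
  (0 , tvar _ , tpair (tvar _) (tvar _)) ,
  (0 , tvar _ , tvar _) , (1 , tpair (tvar _) (tvar _) , tvar _) , (0 , tvar _ , tvar _)

-- The graph of one injection.  Variables w, s, F:
--   ∃x ∃i ∃X. w = ⟨x, ⟨i, x⟩⟩ ∧ i ∈ s ∧ ⟨s, X⟩ ∈ F ∧ x ∈ X.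
injectionFormula : Formula 3
injectionFormula = ∃ᶠ (∃ᶠ (∃ᶠ ((var (# 3) ≐ pair (var (# 2)) (pair (var (# 1)) (var (# 2)))) ∧ᶠ
  ((var (# 1) ∈ᶠ var (# 4)) ∧ᶠ ((pair (var (# 4)) (var (# 0)) ∈ᶠ var (# 5)) ∧ᶠ
   (var (# 2) ∈ᶠ var (# 0)))))))

-- Types: w, x, i at 0;  s, X at 1;  F at 2.
injectionStratified : Stratified injectionFormula
injectionStratified = (λ { zero → 0 ; (suc zero) → 1 ; (suc (suc _)) → 2 }) , 0 , 0 , 1 ,
  (0 , tvar _ , tpair (tvar _) (tpair (tvar _) (tvar _))) ,
  (0 , tvar _ , tvar _) , (1 , tpair (tvar _) (tvar _) , tvar _) , (0 , tvar _ , tvar _)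

-- Where w, s, F sit inside the family formula below (under h, s, p).
injectionVars : Fin 3 → Fin 5
injectionVars zero             = # 0
injectionVars (suc zero)       = # 2
injectionVars (suc (suc zero)) = # 4

-- The family of injections.  Variables p, F:
--   ∃s ∃h. p = ⟨s, h⟩ ∧ (∃X. ⟨s, X⟩ ∈ F) ∧ h is a set
--          ∧ ∀w (w ∈ h ↔ injectionFormula(w, s, F)).
familyFormula : Formula 2
familyFormula = ∃ᶠ (∃ᶠ ((var (# 2) ≐ pair (var (# 1)) (var (# 0))) ∧ᶠ
  ((∃ᶠ (pair (var (# 2)) (var (# 0)) ∈ᶠ var (# 4))) ∧ᶠ
   (((var (# 0) ≐ emp) ∨ᶠ ∃ᶠ (var (# 0) ∈ᶠ var (# 1))) ∧ᶠ
    ∀ᶠ (((var (# 0) ∈ᶠ var (# 1)) ⇒ renameᶠ injectionVars injectionFormula) ∧ᶠ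
        (renameᶠ injectionVars injectionFormula ⇒ (var (# 0) ∈ᶠ var (# 1))))))))

-- Types: p, s, h at 1;  F at 2;  the inner variables as in injectionStratified.
familyStratified : Stratified familyFormula
familyStratified = types , 1 , 1 ,
  (1 , tvar _ , tpair (tvar _) (tvar _)) ,
  (1 , (1 , tpair (tvar _) (tvar _) , tvar _)) ,
  ((1 , tvar _ , temp 1) , 0 , (0 , tvar _ , tvar _)) ,
  0 , ((0 , tvar _ , tvar _) , inner) , (inner , (0 , tvar _ , tvar _))
  where
  types : Fin 2 → ℕ
  types zero    = 1
  types (suc _) = 2
  inner : Strat (0 ∷ᵗ (1 ∷ᵗ (1 ∷ᵗ types))) (renameᶠ injectionVars injectionFormula)
  inner = 0 , 0 , 1 ,
    (0 , tvar _ , tpair (tvar _) (tpair (tvar _) (tvar _))) ,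
    (0 , tvar _ , tvar _) , (1 , tpair (tvar _) (tvar _) , tvar _) , (0 , tvar _ , tvar _)

-- The copairing of a cocone g.  Variables z, g:
--   ∃i ∃x ∃y ∃s ∃h. z = ⟨⟨i, x⟩, y⟩ ∧ i ∈ s ∧ ⟨s, h⟩ ∈ g ∧ ⟨x, y⟩ ∈ h.
copairFormula : Formula 2
copairFormula = ∃ᶠ (∃ᶠ (∃ᶠ (∃ᶠ (∃ᶠ
  ((var (# 5) ≐ pair (pair (var (# 4)) (var (# 3))) (var (# 2))) ∧ᶠ
   ((var (# 4) ∈ᶠ var (# 1)) ∧ᶠ ((pair (var (# 1)) (var (# 0)) ∈ᶠ var (# 6)) ∧ᶠ
    (pair (var (# 3)) (var (# 2)) ∈ᶠ var (# 0)))))))))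

-- Types: z, i, x, y at 0;  s, h at 1;  g at 2.
copairStratified : Stratified copairFormula
copairStratified = (λ { zero → 0 ; (suc _) → 2 }) , 0 , 0 , 0 , 1 , 1 ,
  (0 , tvar _ , tpair (tpair (tvar _) (tvar _)) (tvar _)) ,
  (0 , tvar _ , tvar _) , (1 , tpair (tvar _) (tvar _) , tvar _) ,
  (0 , tpair (tvar _) (tvar _) , tvar _)

module InModel (lem : ExcludedMiddle 0ℓ) (M : NFUModel) where
  open NFUModel M
  open Structure structure
  open Sem structure

  -- Comprehension yielding a set (an object of Rel): comprehension may return
  -- an atom when the extension is empty, in which case we use ∅ instead.
  setComprehension : {n : ℕ} (φ : Formula (ℕ.suc n)) → Stratified φ → (ρ : Fin n → U) →
    Σ[ y ∈ U ] (IsSet y × ((x : U) → (x ∈ y) ⇔ Sat (x ∷ᵛ ρ) φ))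
  setComprehension φ st ρ with comp φ st ρ
  ... | y , spec with lem {Nonempty y}
  ... | yes ne = y , inj₂ ne , spec
  ... | no ¬ne = ∅ , inj₁ refl , λ x →
    mk⇔ (λ p → ⊥-elim (empty x p)) (λ p → ⊥-elim (¬ne (x , from (spec x) p)))

  -- Extensionality for sets: NFU's axiom covers nonempty sets, and ∅ is the
  -- only set without elements.
  setExt : {a b : U} → IsSet a → IsSet b → ((z : U) → (z ∈ a) ⇔ (z ∈ b)) → a ≡ b
  setExt {a} {b} (inj₂ ne) _ e = ext a b ne e
  setExt {a} {b} (inj₁ _) (inj₂ ne) e = sym (ext b a ne (λ z → mk⇔ (from (e z)) (to (e z))))
  setExt (inj₁ a∅) (inj₁ b∅) _ = trans a∅ (sym b∅)

  pairInj₁ : {a b c d : U} → ⟨ a , b ⟩ ≡ ⟨ c , d ⟩ → a ≡ c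
  pairInj₁ e = proj₁ (pairAx _ _ _ _ e)

  pairInj₂ : {a b c d : U} → ⟨ a , b ⟩ ≡ ⟨ c , d ⟩ → b ≡ d
  pairInj₂ e = proj₂ (pairAx _ _ _ _ e)

  fnDomain : {f : U} {D : U → Set} → IsFnOn f D → {a b : U} → ⟨ a , b ⟩ ∈ f → D a
  fnDomain (dom , _) m with dom _ m
  ... | x , y , e , Dx = subst _ (sym (pairInj₁ e)) Dx

  fnValue : {f : U} {D : U → Set} → IsFnOn f D → {a : U} → D a → Σ[ b ∈ U ] ⟨ a , b ⟩ ∈ f
  fnValue (_ , total , _) = total _

  fnUnique : {f : U} {D : U → Set} → IsFnOn f D → {a b b' : U} →
    ⟨ a , b ⟩ ∈ f → ⟨ a , b' ⟩ ∈ f → b ≡ b'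
  fnUnique (_ , _ , unique) = unique _ _ _

  singletonElem : {s : U} → (S : IsSingleton s) → proj₁ S ∈ s
  singletonElem (i , e) = from (e i) refl

  singletonUnique : {s i j : U} → IsSingleton s → i ∈ s → j ∈ s → i ≡ j
  singletonUnique (k , e) p q = trans (to (e _) p) (sym (to (e _) q))

  singletonsMeet : {s s' i : U} → IsSingleton s → IsSingleton s' → i ∈ s → i ∈ s' → s ≡ s'
  singletonsMeet {s} {s'} {i} S S' p p' = ext s s' (i , p) λ z → mk⇔
    (λ q → subst (_∈ s') (sym (singletonUnique S q p)) p')
    (λ q → subst (_∈ s) (sym (singletonUnique S' q p')) p)

  module Coproduct (F : U) (functor : IsFunctorSingRel F) where
    fibres : IsFnOn F IsSingleton
    fibres = proj₁ functor

    CMember : U → Set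
    CMember z = Σ[ i ∈ U ] Σ[ s ∈ U ] Σ[ X ∈ U ] Σ[ x ∈ U ]
      (z ≡ ⟨ i , x ⟩ × i ∈ s × ⟨ s , X ⟩ ∈ F × x ∈ X)

    CExists : Σ[ C ∈ U ] (IsSet C × ((z : U) → (z ∈ C) ⇔ CMember z))
    CExists = setComprehension unionFormula unionStratified (λ _ → F)

    C : U
    C = proj₁ CExists

    CElim : {z : U} → z ∈ C → CMember z
    CElim = to (proj₂ (proj₂ CExists) _)

    CIntro : {i s X x : U} → i ∈ s → ⟨ s , X ⟩ ∈ F → x ∈ X → ⟨ i , x ⟩ ∈ C
    CIntro is sX xX = from (proj₂ (proj₂ CExists) _) (_ , _ , _ , _ , refl , is , sX , xX)

    InjectionMember : U → U → Set
    InjectionMember s w = Σ[ x ∈ U ] Σ[ i ∈ U ] Σ[ X ∈ U ]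
      (w ≡ ⟨ x , ⟨ i , x ⟩ ⟩ × i ∈ s × ⟨ s , X ⟩ ∈ F × x ∈ X)

    injectionAt : (s : U) → Σ[ h ∈ U ] (IsSet h × ((w : U) → (w ∈ h) ⇔ InjectionMember s w))
    injectionAt s = setComprehension injectionFormula injectionStratified (s ∷ᵛ (F ∷ᵛ λ ()))

    FamilyMember : U → Set
    FamilyMember p = Σ[ s ∈ U ] Σ[ h ∈ U ] (p ≡ ⟨ s , h ⟩ × (Σ[ X ∈ U ] ⟨ s , X ⟩ ∈ F) ×
      IsSet h × ((w : U) → ((w ∈ h) → InjectionMember s w) × (InjectionMember s w → w ∈ h)))

    familyExists : Σ[ ι ∈ U ] (IsSet ι × ((p : U) → (p ∈ ι) ⇔ FamilyMember p))
    familyExists = setComprehension familyFormula familyStratified (F ∷ᵛ λ ())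

    ι : U
    ι = proj₁ familyExists

    injectionSpec : {s h : U} → ⟨ s , h ⟩ ∈ ι →
      IsSet h × ((w : U) → (w ∈ h) ⇔ InjectionMember s w)
    injectionSpec m with to (proj₂ (proj₂ familyExists) _) m
    ... | s , h , e , _ , hSet , spec with pairInj₁ e | pairInj₂ e
    ... | refl | refl = hSet , λ w → mk⇔ (proj₁ (spec w)) (proj₂ (spec w))

    ιFunction : IsFnOn ι IsSingleton
    ιFunction = domain , total , unique
      where
      domain : (p : U) → p ∈ ι → Σ[ s ∈ U ] Σ[ h ∈ U ] (p ≡ ⟨ s , h ⟩ × IsSingleton s)
      domain p m with to (proj₂ (proj₂ familyExists) p) m
      ... | s , h , e , (X , sX) , _ = s , h , e , fnDomain fibres sX
      total : (s : U) → IsSingleton s → Σ[ h ∈ U ] ⟨ s , h ⟩ ∈ ι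
      total s S with fnValue fibres S | injectionAt s
      ... | X , sX | h , hSet , spec = h , from (proj₂ (proj₂ familyExists) _)
        (s , h , refl , (X , sX) , hSet , λ w → to (spec w) , from (spec w))
      unique : (s h h' : U) → ⟨ s , h ⟩ ∈ ι → ⟨ s , h' ⟩ ∈ ι → h ≡ h'
      unique s h h' m m' with injectionSpec m | injectionSpec m'
      ... | hSet , spec | hSet' , spec' = setExt hSet hSet' λ w →
        mk⇔ (λ r → from (spec' w) (to (spec w) r)) (λ r → from (spec w) (to (spec' w) r))

    injectionIn : {s h i X x : U} → ⟨ s , h ⟩ ∈ ι → i ∈ s → ⟨ s , X ⟩ ∈ F → x ∈ X →
      ⟨ x , ⟨ i , x ⟩ ⟩ ∈ h
    injectionIn sh is sX xX = from (proj₂ (injectionSpec sh) _) (_ , _ , _ , refl , is , sX , xX)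

    injectionOut : {s h a b : U} → ⟨ s , h ⟩ ∈ ι → ⟨ a , b ⟩ ∈ h →
      Σ[ i ∈ U ] (b ≡ ⟨ i , a ⟩ × i ∈ s)
    injectionOut sh m with to (proj₂ (injectionSpec sh) _) m
    ... | x , i , X , e , is , _ with pairInj₁ e | pairInj₂ e
    ... | refl | refl = i , refl , is

    injectionHom : (s X h : U) → ⟨ s , X ⟩ ∈ F → ⟨ s , h ⟩ ∈ ι → Hom X C h
    injectionHom s X h sX sh = proj₁ (injectionSpec sh) , inC
      where
      inC : (w : U) → w ∈ h → Σ[ a ∈ U ] Σ[ b ∈ U ] (w ≡ ⟨ a , b ⟩ × a ∈ X × b ∈ C)
      inC w m with to (proj₂ (injectionSpec sh) w) m
      ... | x , i , X' , e , is , sX' , xX' with fnUnique fibres sX' sX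
      ... | refl = x , ⟨ i , x ⟩ , e , xX' , CIntro is sX' xX'

    Factors : U → U → Set
    Factors v g = (s i h : U) → ⟨ s , i ⟩ ∈ ι → ⟨ s , h ⟩ ∈ g → IsComp v i h

    compositeWithInjection : {Y v s j h i x y : U} → Hom C Y v → ⟨ s , j ⟩ ∈ ι →
      IsComp v j h → i ∈ s → (⟨ ⟨ i , x ⟩ , y ⟩ ∈ v) ⇔ (⟨ x , y ⟩ ∈ h)
    compositeWithInjection {v = v} {s} {j} {h} {i} {x} {y} vHom sj comp is = mk⇔ restrict extend
      where
      S : IsSingleton s
      S = fnDomain ιFunction sj
      restrict : ⟨ ⟨ i , x ⟩ , y ⟩ ∈ v → ⟨ x , y ⟩ ∈ h
      restrict m with proj₂ vHom _ m
      ... | a , b , e , aC , _ with CElim (subst (_∈ C) (sym (pairInj₁ e)) aC)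
      ... | i' , s' , X , x' , e' , is' , s'X , xX with pairInj₁ e' | pairInj₂ e'
      ... | refl | refl with singletonsMeet (fnDomain fibres s'X) S is' is
      ... | refl = from (comp _) (x , ⟨ i , x ⟩ , y , refl , injectionIn sj is s'X xX , m)
      extend : ⟨ x , y ⟩ ∈ h → ⟨ ⟨ i , x ⟩ , y ⟩ ∈ v
      extend m with to (comp _) m
      ... | a , b , c , e , ab , bc with pairInj₁ e | pairInj₂ e
      ... | refl | refl with injectionOut sj ab
      ... | i' , refl , i's with singletonUnique S i's is
      ... | refl = bc

    -- Uniqueness: the injections are jointly epic, so a map out of C is
    -- determined by the cocone it induces.
    determinedByCocone : {Y g v w : U} → IsFnOn g IsSingleton →
      Hom C Y v → Factors v g → Hom C Y w → Factors w g → v ≡ w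
    determinedByCocone {g = g} gFn vHom vF wHom wF =
      setExt (proj₁ vHom) (proj₁ wHom) λ z → mk⇔ (transfer vHom vF wHom wF) (transfer wHom wF vHom vF)
      where
      transfer : {Y v w z : U} → Hom C Y v → Factors v g → Hom C Y w → Factors w g → z ∈ v → z ∈ w
      transfer vHom vF wHom wF m with proj₂ vHom _ m
      ... | a , b , refl , aC , _ with CElim aC
      ... | i , s , X , x , refl , is , sX , _ with fnDomain fibres sX
      ... | S with fnValue ιFunction S | fnValue gFn S
      ... | j , sj | h , sh =
        from (compositeWithInjection wHom sj (wF s j h sj sh) is)
          (to (compositeWithInjection vHom sj (vF s j h sj sh) is) m)

    module Copairing (Y g : U) (gFn : IsFnOn g IsSingleton)
      (gCocone : (s X h : U) → ⟨ s , X ⟩ ∈ F → ⟨ s , h ⟩ ∈ g → Hom X Y h) where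

      CopairMember : U → Set
      CopairMember z = Σ[ i ∈ U ] Σ[ x ∈ U ] Σ[ y ∈ U ] Σ[ s ∈ U ] Σ[ h ∈ U ]
        (z ≡ ⟨ ⟨ i , x ⟩ , y ⟩ × i ∈ s × ⟨ s , h ⟩ ∈ g × ⟨ x , y ⟩ ∈ h)

      copairExists : Σ[ u ∈ U ] (IsSet u × ((z : U) → (z ∈ u) ⇔ CopairMember z))
      copairExists = setComprehension copairFormula copairStratified (g ∷ᵛ λ ())

      u : U
      u = proj₁ copairExists

      copairIn : {i s h x y : U} → i ∈ s → ⟨ s , h ⟩ ∈ g → ⟨ x , y ⟩ ∈ h → ⟨ ⟨ i , x ⟩ , y ⟩ ∈ u
      copairIn is sh xy = from (proj₂ (proj₂ copairExists) _) (_ , _ , _ , _ , _ , refl , is , sh , xy)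

      copairHom : Hom C Y u
      copairHom = proj₁ (proj₂ copairExists) , inCY
        where
        inCY : (z : U) → z ∈ u → Σ[ a ∈ U ] Σ[ b ∈ U ] (z ≡ ⟨ a , b ⟩ × a ∈ C × b ∈ Y)
        inCY z m with to (proj₂ (proj₂ copairExists) z) m
        ... | i , x , y , s , h , e , is , sh , xy with fnValue fibres (fnDomain gFn sh)
        ... | X , sX with proj₂ (gCocone s X h sX sh) _ xy
        ... | a , b , e' , aX , bY with pairInj₁ e' | pairInj₂ e'
        ... | refl | refl = ⟨ i , x ⟩ , y , e , CIntro is sX aX , bY

      copairFactors : Factors u g
      copairFactors s j h sj sh z = mk⇔ split merge
        where
        S : IsSingleton s
        S = fnDomain gFn sh
        split : z ∈ h → Σ[ a ∈ U ] Σ[ b ∈ U ] Σ[ c ∈ U ]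
          (z ≡ ⟨ a , c ⟩ × ⟨ a , b ⟩ ∈ j × ⟨ b , c ⟩ ∈ u)
        split m with fnValue fibres S
        ... | X , sX with proj₂ (gCocone s X h sX sh) z m
        ... | a , c , refl , aX , _ = a , ⟨ proj₁ S , a ⟩ , c , refl ,
          injectionIn sj (singletonElem S) sX aX , copairIn (singletonElem S) sh m
        merge : Σ[ a ∈ U ] Σ[ b ∈ U ] Σ[ c ∈ U ]
          (z ≡ ⟨ a , c ⟩ × ⟨ a , b ⟩ ∈ j × ⟨ b , c ⟩ ∈ u) → z ∈ h
        merge (a , b , c , refl , ab , bc) with injectionOut sj ab
        ... | i , refl , is with to (proj₂ (proj₂ copairExists) _) bc
        ... | i' , x' , y' , s' , h' , e , i's' , s'h' , xy with pairInj₁ e | pairInj₂ e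
        ... | e₁ | refl with pairInj₁ e₁ | pairInj₂ e₁
        ... | refl | refl with singletonsMeet S (fnDomain gFn s'h') is i's'
        ... | refl with fnUnique gFn sh s'h'
        ... | refl = xy

    coproduct : Σ[ C' ∈ U ] Σ[ ι' ∈ U ] IsCoproduct F C' ι'
    coproduct = C , ι , proj₁ (proj₂ CExists) , ιFunction , injectionHom , universal
      where
      universal : (Y : U) → IsSet Y → (g : U) → IsFnOn g IsSingleton →
        ((s X h : U) → ⟨ s , X ⟩ ∈ F → ⟨ s , h ⟩ ∈ g → Hom X Y h) →
        Σ[ v ∈ U ] (Hom C Y v × Factors v g ×
          ((v' : U) → Hom C Y v' → Factors v' g → v' ≡ v))
      universal Y _ g gFn gCocone = u , copairHom , copairFactors ,
        λ v' v'Hom v'Factors → determinedByCocone gFn v'Hom v'Factors copairHom copairFactors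
        where open Copairing Y g gFn gCocone

proposition5p9 : ExcludedMiddle 0ℓ → (M : NFUModel) →
    Sem.RelHasSingCoproducts (NFUModel.structure M)
proposition5p9 lem M F functor = InModel.Coproduct.coproduct lem M F functor
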